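{- For every integer $k\ge0$, $(k+2)$-connectivity cannot be expressed by $\mathrm{FO}+\mathrm{conn}_k$; that is, there is no $\mathrm{FO}+\mathrm{conn}_k$ sentence $\varphi$ over $\{E\}$ such that for every finite graph $G$, $G\models\varphi$ iff $G$ is $(k+2)$-connected. In particular, the hierarchy is strict: $\mathrm{FO}+\mathrm{conn}_0\subsetneq\mathrm{FO}+\mathrm{conn}_1\subsetneq\mathrm{FO}+\mathrm{conn}_2\subsetneq\cdots$, where $\mathrm{FO}+\mathrm{conn}_k$ here denotes the class of graph properties expressible by $\mathrm{FO}+\mathrm{conn}_k$ sentences.
   Context: Graphs are finite simple undirected graphs viewed as $\{E\}$-structures. A graph $G$ is $m$-connected if it has more than $m$ vertices and $G-X$ is connected for every $X\subseteq V(G)$ with $|X|<m$. Separator logic is first-order logic over $\{E\}\cup\{\mathrm{conn}_\ell:\ell\ge0\}$, where $\mathrm{conn}_\ell$ is $(\ell+2)$-ary and $G\models\mathrm{conn}_\ell(a,b,c_1,\dots,c_\ell)$ iff $a$ and $b$ are connected by a path in $G-\{c_1,\dots,c_\ell\}$ (false if $a$ or $b$ equals some $c_i$). $\mathrm{FO}+\mathrm{conn}_k$ is the fragment using only the predicates $\mathrm{conn}_\ell$ with $\ell\le k$. -}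

module Defs where

open import Data.Nat using (ℕ; suc; _+_; _≤_; _<_)
open import Data.Bool using (Bool; true; false; T)
open import Data.Fin using (Fin)
import Data.Fin as F
open import Data.Fin.Subset using (Subset; ∣_∣) renaming (_∈_ to _∈ₛ_)
open import Data.Vec using (Vec)
import Data.Vec
open import Data.Vec.Membership.Propositional using () renaming (_∈_ to _∈ᵥ_)
open import Data.Product using (Σ; _×_; ∃)
open import Data.Sum using (_⊎_)
open import Data.Empty using (⊥)
open import Data.Unit using (⊤)
open import Relation.Nullary using (¬_)
open import Relation.Binary.PropositionalEquality using (_≡_)

record Graph : Set where
  field
    n      : ℕ
    E      : Fin n → Fin n → Bool
    sym    : ∀ u v → E u v ≡ E v u
    irrefl : ∀ v → E v v ≡ false

open Graph public

Adj : (G : Graph) → Fin (n G) → Fin (n G) → Set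
Adj G u v = T (E G u v)

data Reach (G : Graph) (Avoid : Fin (n G) → Set) : Fin (n G) → Fin (n G) → Set where
  here : ∀ {a} → ¬ Avoid a → Reach G Avoid a a
  step : ∀ {a b c} → ¬ Avoid a → Adj G a b → Reach G Avoid b c → Reach G Avoid a c

Connected-minus : (G : Graph) → Subset (n G) → Set
Connected-minus G X =
  ∀ a b → ¬ (a ∈ₛ X) → ¬ (b ∈ₛ X) → Reach G (λ v → v ∈ₛ X) a b

IsConnectedₘ : ℕ → Graph → Set
IsConnectedₘ m G = (m < n G) × (∀ (X : Subset (n G)) → ∣ X ∣ < m → Connected-minus G X)

-- Syntax of FO + conn_k with m free variables (de Bruijn, Fin m)

data Formula (k : ℕ) : ℕ → Set where
  edge  : ∀ {m} → Fin m → Fin m → Formula k m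
  equal : ∀ {m} → Fin m → Fin m → Formula k m
  conn  : ∀ {m} (ℓ : ℕ) → ℓ ≤ k → Fin m → Fin m → Vec (Fin m) ℓ → Formula k m
  false' : ∀ {m} → Formula k m
  true'  : ∀ {m} → Formula k m
  neg   : ∀ {m} → Formula k m → Formula k m
  and   : ∀ {m} → Formula k m → Formula k m → Formula k m
  or    : ∀ {m} → Formula k m → Formula k m → Formula k m
  ex    : ∀ {m} → Formula k (suc m) → Formula k m
  all   : ∀ {m} → Formula k (suc m) → Formula k m

Sentence : ℕ → Set
Sentence k = Formula k 0

extend : ∀ {m} {A : Set} → A → (Fin m → A) → Fin (suc m) → A
extend x ρ F.zero    = x
extend x ρ (F.suc i) = ρ i

mapVec : ∀ {A B : Set} {ℓ} → (A → B) → Vec A ℓ → Vec B ℓ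
mapVec = Data.Vec.map

Sat : ∀ {k m} (G : Graph) → (Fin m → Fin (n G)) → Formula k m → Set
Sat G ρ (edge x y)        = Adj G (ρ x) (ρ y)
Sat G ρ (equal x y)       = ρ x ≡ ρ y
Sat G ρ (conn ℓ _ a b cs) =
  Reach G (λ v → v ∈ᵥ mapVec ρ cs) (ρ a) (ρ b)
Sat G ρ false'            = ⊥
Sat G ρ true'             = ⊤

Sat G ρ (neg φ)           = ¬ Sat G ρ φ
Sat G ρ (and φ ψ)         = Sat G ρ φ × Sat G ρ ψ
Sat G ρ (or φ ψ)          = Sat G ρ φ ⊎ Sat G ρ ψ
Sat G ρ (ex φ)            = Σ (Fin (n G)) λ v → Sat G (extend v ρ) φ
Sat G ρ (all φ)           = ∀ (v : Fin (n G)) → Sat G (extend v ρ) φ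

noVars : ∀ {A : Set} → Fin 0 → A
noVars ()

_⊨_ : ∀ {k} → Graph → Sentence k → Set
G ⊨ φ = Sat G noVars φ

GraphProperty : Set₁
GraphProperty = Graph → Set

Expressible : ℕ → GraphProperty → Set
Expressible k P = Σ (Sentence k) λ φ → ∀ G → ((G ⊨ φ → P G) × (P G → G ⊨ φ))

-- The witnesses are cones: k + 1 apexes adjacent to every vertex, over a rim that is either one
-- cycle of length 2N or two cycles of length N.  Removing at most k vertices always leaves an
-- apex, so in a cone every conn_ℓ atom with ℓ ≤ k only says that its two endpoints survive; thus
-- FO + conn_k sees no more of the rim than first-order logic over its successor function, and the
-- usual Ehrenfeucht–Fraïssé argument for successor structures (distance threshold 2^(r+1) with r
-- rounds left) shows that the two cones satisfy the same sentences of quantifier rank Q once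
-- N > 2^(Q+1)·Q.  Removing the k + 1 apexes disconnects the two-cycle cone but not the one-cycle
-- cone, so neither (k+2)-connectivity nor the FO + conn_{k+1} sentence "no k + 1 vertices separate
-- two others" is expressible in FO + conn_k.
module Submission where

open import Defs hiding (sym; E; n; irrefl)
open import Data.Bool using (Bool; true; false)
open import Data.Fin using (Fin; toℕ; fromℕ<; _↑ˡ_; _↑ʳ_; splitAt; join)
import Data.Fin as F
import Data.Fin.Properties as FP
open import Data.Fin.Subset using (Subset; ∣_∣; inside; outside) renaming (_∈_ to _∈ₛ_; _∉_ to _∉ₛ_)
import Data.Fin.Subset.Properties as SP
open import Data.Nat using (ℕ; zero; suc; _+_; _*_; _∸_; _≤_; _<_; _⊔_; z≤n; s≤s; _<?_; NonZero)
open import Data.Nat.DivMod using (_%_; m%n<n; m<n⇒m%n≡m; [m+n]%n≡m%n; %-distribˡ-+; m%n%n≡m%n)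
open import Data.Nat.Properties
open import Data.Product using (Σ; _×_; _,_; proj₁; proj₂; ∃; ∃₂)
open import Data.Product.Function.NonDependent.Propositional using (_×-⇔_)
open import Data.Sum using (_⊎_; inj₁; inj₂; [_,_]′)
import Data.Sum as Sum
open import Data.Sum.Function.Propositional using (_⊎-⇔_)
open import Data.Unit using (tt)
open import Data.Vec using (Vec; []; _∷_; lookup; replicate; _++_)
import Data.Vec as Vec
open import Data.Vec.Properties using (map-∘)
open import Data.Vec.Membership.Propositional using (_∈_; _∉_)
import Data.Vec.Membership.DecPropositional as DecMembership
open import Data.Vec.Relation.Unary.Any using (here; there; index)
open import Data.Vec.Relation.Unary.Any.Properties using (lookup-index)
open import Function using (_∘_; id; const)
open import Function.Bundles using (_⇔_; mk⇔; Equivalence)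
open import Function.Construct.Symmetry using (⇔-sym)
open import Function.Definitions using (Injective)
open import Function.Related.Propositional using (module EquationalReasoning)
open import Function.Related.TypeIsomorphisms using (¬-cong-⇔)
open import Relation.Binary using (tri<; tri≈; tri>)
open import Relation.Binary.PropositionalEquality
open import Relation.Nullary using (¬_; Dec; yes; no; contradiction)
open import Relation.Nullary.Decidable using (⌊_⌋; toWitness; fromWitness; _×-dec_; _⊎-dec_; ¬?)

infixr 9 _^_
_^_ : {A : Set} → (A → A) → ℕ → A → A
(f ^ zero) x = x
(f ^ suc d) x = f ((f ^ d) x)

module _ {A : Set} (f : A → A) where

  ^-+ : ∀ a b x → (f ^ a) ((f ^ b) x) ≡ (f ^ (a + b)) x
  ^-+ zero    b x = refl
  ^-+ (suc a) b x = cong f (^-+ a b x)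

  ^-comm : ∀ a b x → (f ^ a) ((f ^ b) x) ≡ (f ^ b) ((f ^ a) x)
  ^-comm a b x = begin
    (f ^ a) ((f ^ b) x) ≡⟨ ^-+ a b x ⟩
    (f ^ (a + b)) x     ≡⟨ cong (λ d → (f ^ d) x) (+-comm a b) ⟩
    (f ^ (b + a)) x     ≡⟨ ^-+ b a x ⟨
    (f ^ b) ((f ^ a) x) ∎
    where open ≡-Reasoning

  ^-injective : Injective _≡_ _≡_ f → ∀ d → Injective _≡_ _≡_ (f ^ d)
  ^-injective inj zero    e = e
  ^-injective inj (suc d) e = ^-injective inj d (inj e)

  ^-preserves : (P : A → Set) → (∀ {x} → P x → P (f x)) → ∀ d {x} → P x → P ((f ^ d) x)
  ^-preserves P pres zero    p = p
  ^-preserves P pres (suc d) p = pres (^-preserves P pres d p)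

  ^-fixed : ∀ {x} → f x ≡ x → ∀ d → (f ^ d) x ≡ x
  ^-fixed fx zero    = refl
  ^-fixed fx (suc d) = trans (cong f (^-fixed fx d)) fx

^-commute : ∀ {A B : Set} {f : A → A} {g : B → B} (h : A → B) →
            (∀ x → h (f x) ≡ g (h x)) → ∀ d x → h ((f ^ d) x) ≡ (g ^ d) (h x)
^-commute h comm zero    x = refl
^-commute {g = g} h comm (suc d) x = trans (comm _) (cong g (^-commute h comm d x))

^-inverse : ∀ {A : Set} {f g : A → A} → (∀ y → f (g y) ≡ y) → ∀ d x → (f ^ d) ((g ^ d) x) ≡ x
^-inverse fg zero    x = refl
^-inverse {f = f} {g} fg (suc d) x = begin
  (f ^ suc d) ((g ^ suc d) x)   ≡⟨ ^-comm f d 1 _ ⟨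
  (f ^ d) (f (g ((g ^ d) x)))   ≡⟨ cong (f ^ d) (fg _) ⟩
  (f ^ d) ((g ^ d) x)           ≡⟨ ^-inverse fg d x ⟩
  x                             ∎
  where open ≡-Reasoning

data SumView (m n : ℕ) : Fin (m + n) → Set where
  inl : ∀ i → SumView m n (i ↑ˡ n)
  inr : ∀ j → SumView m n (m ↑ʳ j)

sumView : ∀ m n x → SumView m n x
sumView zero    n x        = inr x
sumView (suc m) n F.zero   = inl F.zero
sumView (suc m) n (F.suc x) with sumView m n x
... | inl i = inl (F.suc i)
... | inr j = inr j

infixr 5 _⊕_
_⊕_ : ∀ {m n} → (Fin m → Fin m) → (Fin n → Fin n) → Fin (m + n) → Fin (m + n)
_⊕_ {m} {n} f g = join m n ∘ Sum.map f g ∘ splitAt m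

module _ {m n} (f : Fin m → Fin m) (g : Fin n → Fin n) where

  ⊕-↑ˡ : ∀ i → (f ⊕ g) (i ↑ˡ n) ≡ f i ↑ˡ n
  ⊕-↑ˡ i rewrite FP.splitAt-↑ˡ m i n = refl

  ⊕-↑ʳ : ∀ j → (f ⊕ g) (m ↑ʳ j) ≡ m ↑ʳ g j
  ⊕-↑ʳ j rewrite FP.splitAt-↑ʳ m n j = refl

  ^-⊕-↑ˡ : ∀ d i → ((f ⊕ g) ^ d) (i ↑ˡ n) ≡ (f ^ d) i ↑ˡ n
  ^-⊕-↑ˡ d i = sym (^-commute (_↑ˡ n) (λ i → sym (⊕-↑ˡ i)) d i)

  ^-⊕-↑ʳ : ∀ d j → ((f ⊕ g) ^ d) (m ↑ʳ j) ≡ m ↑ʳ (g ^ d) j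
  ^-⊕-↑ʳ d j = sym (^-commute (m ↑ʳ_) (λ j → sym (⊕-↑ʳ j)) d j)

⊕-inverse : ∀ {m n} {f f′ : Fin m → Fin m} {g g′ : Fin n → Fin n} →
            (∀ i → f (f′ i) ≡ i) → (∀ j → g (g′ j) ≡ j) → ∀ x → (f ⊕ g) ((f′ ⊕ g′) x) ≡ x
⊕-inverse {m} {n} {f} {f′} {g} {g′} ff′ gg′ x with sumView m n x
... | inl i = trans (cong (f ⊕ g) (⊕-↑ˡ f′ g′ i)) (trans (⊕-↑ˡ f g (f′ i)) (cong (_↑ˡ n) (ff′ i)))
... | inr j = trans (cong (f ⊕ g) (⊕-↑ʳ f′ g′ j)) (trans (⊕-↑ʳ f g (g′ j)) (cong (m ↑ʳ_) (gg′ j)))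

inLeft : ∀ m {n} → Fin (m + n) → Bool
inLeft m x = [ const true , const false ]′ (splitAt m x)

inLeft-↑ˡ : ∀ {m} n (i : Fin m) → inLeft m (i ↑ˡ n) ≡ true
inLeft-↑ˡ {m} n i rewrite FP.splitAt-↑ˡ m i n = refl

inLeft-↑ʳ : ∀ m {n} (j : Fin n) → inLeft m (m ↑ʳ j) ≡ false
inLeft-↑ʳ m {n} j rewrite FP.splitAt-↑ʳ m n j = refl

inLeft-⊕ : ∀ {m n} (f : Fin m → Fin m) (g : Fin n → Fin n) x → inLeft m ((f ⊕ g) x) ≡ inLeft m x
inLeft-⊕ {m} {n} f g x with sumView m n x
... | inl i = trans (cong (inLeft m) (⊕-↑ˡ f g i)) (trans (inLeft-↑ˡ n (f i)) (sym (inLeft-↑ˡ n i)))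
... | inr j = trans (cong (inLeft m) (⊕-↑ʳ f g j)) (trans (inLeft-↑ʳ m (g j)) (sym (inLeft-↑ʳ m j)))

[m+n]%o≢m : ∀ {m n o} .{{_ : NonZero o}} → m < o → 0 < n → n < o → (m + n) % o ≢ m
[m+n]%o≢m {m} {n} {o} m<o 0<n n<o eq with m + n <? o
... | yes m+n<o = <⇒≢ (m<m+n m 0<n) (sym (trans (sym (m<n⇒m%n≡m m+n<o)) eq))
... | no m+n≮o with m≤n⇒∃[o]m+o≡n (≮⇒≥ m+n≮o)
...   | e , o+e≡m+n = <⇒≢ n<o (sym (+-cancelˡ-≡ m o n (trans (+-comm m o) (trans (cong (o +_) (sym e≡m)) o+e≡m+n))))
  where
  e<o : e < o
  e<o = +-cancelˡ-< o e o (subst (_< o + o) (sym o+e≡m+n) (+-mono-< m<o n<o))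
  e≡m : e ≡ m
  e≡m = begin
    e             ≡⟨ m<n⇒m%n≡m e<o ⟨
    e % o         ≡⟨ [m+n]%n≡m%n e o ⟨
    (e + o) % o   ≡⟨ cong (_% o) (trans (+-comm e o) o+e≡m+n) ⟩
    (m + n) % o   ≡⟨ eq ⟩
    m             ∎
    where open ≡-Reasoning

[1+m%n]%n≡[1+m]%n : ∀ m n .{{_ : NonZero n}} → suc (m % n) % n ≡ suc m % n
[1+m%n]%n≡[1+m]%n m n = begin
  (1 + m % n) % n               ≡⟨ %-distribˡ-+ 1 (m % n) n ⟩
  (1 % n + m % n % n) % n       ≡⟨ cong (λ z → (1 % n + z) % n) (m%n%n≡m%n m n) ⟩
  (1 % n + m % n) % n           ≡⟨ %-distribˡ-+ 1 m n ⟨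
  (1 + m) % n                   ∎
  where open ≡-Reasoning

rotate : ∀ {m} → Fin (suc m) → Fin (suc m)
rotate {m} i = fromℕ< (m%n<n (suc (toℕ i)) (suc m))

module _ {m : ℕ} where

  toℕ-rotate^ : ∀ d (i : Fin (suc m)) → toℕ ((rotate ^ d) i) ≡ (toℕ i + d) % suc m
  toℕ-rotate^ zero    i = sym (trans (cong (_% suc m) (+-identityʳ (toℕ i))) (m<n⇒m%n≡m (FP.toℕ<n i)))
  toℕ-rotate^ (suc d) i = begin
    toℕ (rotate ((rotate ^ d) i))          ≡⟨ FP.toℕ-fromℕ< _ ⟩
    suc (toℕ ((rotate ^ d) i)) % suc m     ≡⟨ cong (λ z → suc z % suc m) (toℕ-rotate^ d i) ⟩
    suc ((toℕ i + d) % suc m) % suc m      ≡⟨ [1+m%n]%n≡[1+m]%n (toℕ i + d) (suc m) ⟩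
    suc (toℕ i + d) % suc m                ≡⟨ cong (_% suc m) (sym (+-suc (toℕ i) d)) ⟩
    (toℕ i + suc d) % suc m                ∎
    where open ≡-Reasoning

  rotate^-period : ∀ (i : Fin (suc m)) → (rotate ^ suc m) i ≡ i
  rotate^-period i = FP.toℕ-injective
    (trans (toℕ-rotate^ (suc m) i) (trans ([m+n]%n≡m%n (toℕ i) (suc m)) (m<n⇒m%n≡m (FP.toℕ<n i))))

  rotate^-no-short-cycle : ∀ (i : Fin (suc m)) {d} → 0 < d → d < suc m → (rotate ^ d) i ≢ i
  rotate^-no-short-cycle i 0<d d<M eq =
    [m+n]%o≢m (FP.toℕ<n i) 0<d d<M (trans (sym (toℕ-rotate^ _ i)) (cong toℕ eq))

  rotate-transitive : ∀ (i j : Fin (suc m)) → ∃ λ d → (rotate ^ d) i ≡ j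
  rotate-transitive i j = (suc m ∸ toℕ i) + toℕ j , FP.toℕ-injective (begin
    toℕ ((rotate ^ (suc m ∸ toℕ i + toℕ j)) i)  ≡⟨ toℕ-rotate^ _ i ⟩
    (toℕ i + (suc m ∸ toℕ i + toℕ j)) % suc m  ≡⟨ cong (_% suc m) (+-assoc (toℕ i) _ _) ⟨
    (toℕ i + (suc m ∸ toℕ i) + toℕ j) % suc m  ≡⟨ cong (λ z → (z + toℕ j) % suc m) (m+[n∸m]≡n (<⇒≤ (FP.toℕ<n i))) ⟩
    (suc m + toℕ j) % suc m                    ≡⟨ cong (_% suc m) (+-comm (suc m) (toℕ j)) ⟩
    (toℕ j + suc m) % suc m                    ≡⟨ [m+n]%n≡m%n (toℕ j) (suc m) ⟩
    toℕ j % suc m                              ≡⟨ m<n⇒m%n≡m (FP.toℕ<n j) ⟩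
    toℕ j                                      ∎)
    where open ≡-Reasoning

record LongCycles (L N : ℕ) : Set where
  field
    σ σ⁻¹          : Fin L → Fin L
    σ∘σ⁻¹          : ∀ x → σ (σ⁻¹ x) ≡ x
    σ⁻¹∘σ          : ∀ x → σ⁻¹ (σ x) ≡ x
    no-short-cycle : ∀ x {d} → 0 < d → d < N → (σ ^ d) x ≢ x

  orbit-no-return : ∀ x {a b} → a < b → b < N → (σ ^ a) x ≢ (σ ^ b) x
  orbit-no-return x {a} a<b b<N e with m≤n⇒∃[o]m+o≡n a<b
  ... | d , refl = no-short-cycle ((σ ^ a) x) (s≤s z≤n) (≤-<-trans (s≤s (m≤n+m d a)) b<N) (begin
    (σ ^ suc d) ((σ ^ a) x)   ≡⟨ ^-+ σ (suc d) a x ⟩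
    (σ ^ suc (d + a)) x       ≡⟨ cong (λ n → (σ ^ suc n) x) (+-comm d a) ⟩
    (σ ^ suc (a + d)) x       ≡⟨ e ⟨
    (σ ^ a) x                 ∎)
    where open ≡-Reasoning

  orbit-injective : ∀ x {a b} → a < N → b < N → (σ ^ a) x ≡ (σ ^ b) x → a ≡ b
  orbit-injective x {a} {b} a<N b<N e with <-cmp a b
  ... | tri< a<b _ _ = contradiction e (orbit-no-return x a<b b<N)
  ... | tri≈ _ a≡b _ = a≡b
  ... | tri> _ _ b<a = contradiction (sym e) (orbit-no-return x b<a a<N)

rotation : ∀ {m N} → N ≤ suc m → LongCycles (suc m) N
rotation {m} N≤M = record
  { σ              = rotate
  ; σ⁻¹            = rotate ^ m
  ; σ∘σ⁻¹          = rotate^-period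
  ; σ⁻¹∘σ          = λ x → trans (^-comm rotate m 1 x) (rotate^-period x)
  ; no-short-cycle = λ x 0<d d<N → rotate^-no-short-cycle x 0<d (<-≤-trans d<N N≤M)
  }

infixr 5 _⊕ᶜ_
_⊕ᶜ_ : ∀ {L₁ L₂ N} → LongCycles L₁ N → LongCycles L₂ N → LongCycles (L₁ + L₂) N
_⊕ᶜ_ {L₁} {L₂} C₁ C₂ = record
  { σ              = C₁.σ ⊕ C₂.σ
  ; σ⁻¹            = C₁.σ⁻¹ ⊕ C₂.σ⁻¹
  ; σ∘σ⁻¹          = ⊕-inverse C₁.σ∘σ⁻¹ C₂.σ∘σ⁻¹
  ; σ⁻¹∘σ          = ⊕-inverse C₁.σ⁻¹∘σ C₂.σ⁻¹∘σ
  ; no-short-cycle = no-short-cycle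
  }
  where
  module C₁ = LongCycles C₁
  module C₂ = LongCycles C₂
  no-short-cycle : ∀ x {d} → 0 < d → d < _ → ((C₁.σ ⊕ C₂.σ) ^ d) x ≢ x
  no-short-cycle x {d} 0<d d<N e with sumView L₁ L₂ x
  ... | inl i = C₁.no-short-cycle i 0<d d<N
                  (FP.↑ˡ-injective L₂ _ _ (trans (sym (^-⊕-↑ˡ C₁.σ C₂.σ d i)) e))
  ... | inr j = C₂.no-short-cycle j 0<d d<N
                  (FP.↑ʳ-injective L₁ _ _ (trans (sym (^-⊕-↑ʳ C₁.σ C₂.σ d j)) e))

injective-image-⊈ : ∀ {X : Set} {M ℓ} (f : Fin M → X) → Injective _≡_ _≡_ f → ℓ < M →
                    (xs : Vec X ℓ) → ¬ (∀ i → f i ∈ xs)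
injective-image-⊈ f inj ℓ<M xs f⊆xs with FP.pigeonhole ℓ<M (λ i → index (f⊆xs i))
... | i , j , i<j , same = FP.<⇒≢ i<j (inj (begin
  f i                        ≡⟨ lookup-index (f⊆xs i) ⟩
  lookup xs (index (f⊆xs i)) ≡⟨ cong (lookup xs) same ⟩
  lookup xs (index (f⊆xs j)) ≡⟨ lookup-index (f⊆xs j) ⟨
  f j                        ∎))
  where open ≡-Reasoning

module _ {G : Graph} {A : Fin (Graph.n G) → Set} where

  Reach-ends : ∀ {a b} → Reach G A a b → ¬ A a × ¬ A b
  Reach-ends (here ¬a)       = ¬a , ¬a
  Reach-ends (step ¬a _ r)   = ¬a , proj₂ (Reach-ends r)

  infixr 5 _++ᴿ_
  _++ᴿ_ : ∀ {a b c} → Reach G A a b → Reach G A b c → Reach G A a c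
  here _       ++ᴿ r′ = r′
  step ¬a e r  ++ᴿ r′ = step ¬a e (r ++ᴿ r′)

  Reach-edge : ∀ {a b} → ¬ A a → ¬ A b → (a ≢ b → Adj G a b) → Reach G A a b
  Reach-edge {a} {b} ¬a ¬b adj with a FP.≟ b
  ... | yes refl = here ¬a
  ... | no a≢b   = step ¬a (adj a≢b) (here ¬b)

-- K apexes, adjacent to all vertices, over the rim Fin L whose edges are c — σ c.
module Cone (K L : ℕ) (σ : Fin L → Fin L) where

  V : Set
  V = Fin (K + L)

  Apex : V → Set
  Apex x = toℕ x < K

  Apex? : ∀ x → Dec (Apex x)
  Apex? x = toℕ x <? K

  apex : Fin K → V
  apex i = i ↑ˡ L

  rim : Fin L → V
  rim c = K ↑ʳ c

  Apex-apex : ∀ i → Apex (apex i)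
  Apex-apex i = subst (_< K) (sym (FP.toℕ-↑ˡ i L)) (FP.toℕ<n i)

  ¬Apex-rim : ∀ c → ¬ Apex (rim c)
  ¬Apex-rim c a = m+n≮m K (toℕ c) (subst (_< K) (FP.toℕ-↑ʳ K c) a)

  Apex⇒apex : ∀ {x} → Apex x → ∃ λ i → x ≡ apex i
  Apex⇒apex {x} a with sumView K L x
  ... | inl i = i , refl
  ... | inr c = contradiction a (¬Apex-rim c)

  ¬Apex⇒rim : ∀ {x} → ¬ Apex x → ∃ λ c → x ≡ rim c
  ¬Apex⇒rim {x} ¬a with sumView K L x
  ... | inl i = contradiction (Apex-apex i) ¬a
  ... | inr c = c , refl

  s : V → V
  s = id ⊕ σ

  s-Apex : ∀ {x} → Apex x → s x ≡ x
  s-Apex a with Apex⇒apex a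
  ... | i , refl = ⊕-↑ˡ id σ i

  s-rim : ∀ c → s (rim c) ≡ rim (σ c)
  s-rim = ⊕-↑ʳ id σ

  s^-rim : ∀ d c → (s ^ d) (rim c) ≡ rim ((σ ^ d) c)
  s^-rim = ^-⊕-↑ʳ id σ

  s-¬Apex : ∀ {x} → ¬ Apex x → ¬ Apex (s x)
  s-¬Apex ¬a with ¬Apex⇒rim ¬a
  ... | c , refl = subst (λ y → ¬ Apex y) (sym (s-rim c)) (¬Apex-rim (σ c))

  Edge : V → V → Set
  Edge u v = u ≢ v × (Apex u ⊎ Apex v ⊎ s u ≡ v ⊎ s v ≡ u)

  Edge? : ∀ u v → Dec (Edge u v)
  Edge? u v = ¬? (u FP.≟ v) ×-dec (Apex? u ⊎-dec Apex? v ⊎-dec s u FP.≟ v ⊎-dec s v FP.≟ u)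

  Edge-sym : ∀ {u v} → Edge u v → Edge v u
  Edge-sym (u≢v , e) = (λ v≡u → u≢v (sym v≡u)) , flip e
    where
    flip : ∀ {u v} → Apex u ⊎ Apex v ⊎ s u ≡ v ⊎ s v ≡ u → Apex v ⊎ Apex u ⊎ s v ≡ u ⊎ s u ≡ v
    flip (inj₁ a)               = inj₂ (inj₁ a)
    flip (inj₂ (inj₁ a))        = inj₁ a
    flip (inj₂ (inj₂ (inj₁ e))) = inj₂ (inj₂ (inj₂ e))
    flip (inj₂ (inj₂ (inj₂ e))) = inj₂ (inj₂ (inj₁ e))

  graph : Graph
  graph = record
    { n      = K + L
    ; E      = λ u v → ⌊ Edge? u v ⌋
    ; sym    = E-sym
    ; irrefl = E-irrefl
    }
    where
    E-sym : ∀ u v → ⌊ Edge? u v ⌋ ≡ ⌊ Edge? v u ⌋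
    E-sym u v with Edge? u v | Edge? v u
    ... | yes _  | yes _  = refl
    ... | no _   | no _   = refl
    ... | yes e  | no ¬e  = contradiction (Edge-sym e) ¬e
    ... | no ¬e  | yes e  = contradiction (Edge-sym e) ¬e
    E-irrefl : ∀ v → ⌊ Edge? v v ⌋ ≡ false
    E-irrefl v with Edge? v v
    ... | yes (v≢v , _) = contradiction refl v≢v
    ... | no _          = refl

  Adj⇒Edge : ∀ {u v} → Adj graph u v → Edge u v
  Adj⇒Edge = toWitness

  Edge⇒Adj : ∀ {u v} → Edge u v → Adj graph u v
  Edge⇒Adj = fromWitness

  Adj⇔Edge : ∀ {u v} → Adj graph u v ⇔ Edge u v
  Adj⇔Edge = mk⇔ Adj⇒Edge Edge⇒Adj

  module _ {A : V → Set} where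

    reach-via-apex : ∀ i {a b} → ¬ A (apex i) → ¬ A a → ¬ A b → Reach graph A a b
    reach-via-apex i ¬w ¬a ¬b =
      Reach-edge ¬a ¬w (λ a≢w → Edge⇒Adj (a≢w , inj₂ (inj₁ (Apex-apex i)))) ++ᴿ
      Reach-edge ¬w ¬b (λ w≢b → Edge⇒Adj (w≢b , inj₁ (Apex-apex i)))

    reach-along-s : (∀ {x} → ¬ Apex x → ¬ A x) → ∀ d {z} → ¬ Apex z → Reach graph A z ((s ^ d) z)
    reach-along-s rimFree zero    ¬z = here (rimFree ¬z)
    reach-along-s rimFree (suc d) ¬z = reach-along-s rimFree d ¬z ++ᴿ
      Reach-edge (rimFree ¬w) (rimFree (s-¬Apex ¬w)) (λ w≢sw → Edge⇒Adj (w≢sw , inj₂ (inj₂ (inj₁ refl))))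
      where
      ¬w = ^-preserves s (λ x → ¬ Apex x) s-¬Apex d ¬z

    reach-in-cone : (∀ c c′ → ∃ λ d → (σ ^ d) c ≡ c′) → (∀ x → Dec (A x)) →
                    ((∀ i → A (apex i)) → ∀ {x} → ¬ Apex x → ¬ A x) →
                    ∀ {a b} → ¬ A a → ¬ A b → Reach graph A a b
    -- Either some apex survives and joins everything, or all apexes are removed and then nothing
    -- else is, so the rim is the single intact cycle σ.
    reach-in-cone transitive A? small {a} {b} ¬a ¬b with FP.any? (λ i → ¬? (A? (apex i)))
    ... | yes (i , ¬i) = reach-via-apex i ¬i ¬a ¬b
    ... | no ¬∃        = go (sumView K L a) (sumView K L b)
      where
      allApex : ∀ i → A (apex i)
      allApex i with A? (apex i)
      ... | yes Ai = Ai
      ... | no ¬Ai = contradiction (i , ¬Ai) ¬∃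
      go : SumView K L a → SumView K L b → Reach graph A a b
      go (inl i) _       = contradiction (allApex i) ¬a
      go (inr _) (inl j) = contradiction (allApex j) ¬b
      go (inr c) (inr c′) with transitive c c′
      ... | d , σ^dc≡c′ = subst (Reach graph A (rim c)) (trans (s^-rim d c) (cong rim σ^dc≡c′))
                            (reach-along-s (small allApex) d (¬Apex-rim c))

    rim-sides-separated : (side : Fin L → Bool) → (∀ c → side (σ c) ≡ side c) → (∀ i → A (apex i)) →
                          ∀ {c c′} → Reach graph A (rim c) (rim c′) → side c ≡ side c′
    rim-sides-separated side invariant apexes {c} {c′} r =
      subst₂ _≡_ (side-rim c) (side-rim c′) (preserved r)
      where
      sideᵛ : V → Bool
      sideᵛ x = [ const true , side ]′ (splitAt K x)
      side-rim : ∀ c → sideᵛ (rim c) ≡ side c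
      side-rim c rewrite FP.splitAt-↑ʳ K L c = refl
      sideᵛ-s : ∀ x → sideᵛ (s x) ≡ sideᵛ x
      sideᵛ-s x with sumView K L x
      ... | inl i = cong sideᵛ (⊕-↑ˡ id σ i)
      ... | inr c = trans (cong sideᵛ (s-rim c)) (trans (side-rim (σ c)) (trans (invariant c) (sym (side-rim c))))
      ¬Apex-off-A : ∀ {x} → ¬ A x → ¬ Apex x
      ¬Apex-off-A ¬x a with Apex⇒apex a
      ... | i , refl = ¬x (apexes i)
      preserved : ∀ {a b} → Reach graph A a b → sideᵛ a ≡ sideᵛ b
      preserved (here _) = refl
      preserved {a} (step ¬a adj r) with Adj⇒Edge adj
      ... | _ , inj₁ a-apex               = contradiction a-apex (¬Apex-off-A ¬a)
      ... | _ , inj₂ (inj₁ b-apex)        = contradiction b-apex (¬Apex-off-A (proj₁ (Reach-ends r)))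
      ... | _ , inj₂ (inj₂ (inj₁ refl))   = trans (sym (sideᵛ-s a)) (preserved r)
      ... | _ , inj₂ (inj₂ (inj₂ sb≡a))   = trans (cong sideᵛ (sym sb≡a)) (trans (sideᵛ-s _) (preserved r))

  apex-injective : Injective _≡_ _≡_ apex
  apex-injective = FP.↑ˡ-injective L _ _

  open DecMembership (FP._≟_ {K + L}) using (_∈?_)

  apex-outside : ∀ {ℓ} (cs : Vec V ℓ) → ℓ < K → ∃ λ i → apex i ∉ cs
  apex-outside cs ℓ<K with FP.any? (λ i → ¬? (apex i ∈? cs))
  ... | yes found = found
  ... | no ¬found = contradiction apexes⊆cs (injective-image-⊈ apex apex-injective ℓ<K cs)
    where
    apexes⊆cs : ∀ i → apex i ∈ cs
    apexes⊆cs i with apex i ∈? cs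
    ... | yes i∈cs = i∈cs
    ... | no i∉cs  = contradiction (i , i∉cs) ¬found

  Reach-avoiding-few⇔ : ∀ {ℓ} (cs : Vec V ℓ) → ℓ < K → ∀ {a b} →
                        Reach graph (_∈ cs) a b ⇔ (a ∉ cs × b ∉ cs)
  Reach-avoiding-few⇔ cs ℓ<K with apex-outside cs ℓ<K
  ... | i , i∉cs = mk⇔ Reach-ends (λ (a∉ , b∉) → reach-via-apex i i∉cs a∉ b∉)

module ConeOf (K : ℕ) {L N : ℕ} (C : LongCycles L N) where
  open LongCycles C public
  open Cone K L σ public

  p : V → V
  p = id ⊕ σ⁻¹

  s∘p : ∀ x → s (p x) ≡ x
  s∘p = ⊕-inverse (λ _ → refl) σ∘σ⁻¹

  s-injective : Injective _≡_ _≡_ s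
  s-injective {x} {y} e = trans (sym (p∘s x)) (trans (cong p e) (p∘s y))
    where
    p∘s : ∀ x → p (s x) ≡ x
    p∘s = ⊕-inverse (λ _ → refl) σ⁻¹∘σ

  p-¬Apex : ∀ {x} → ¬ Apex x → ¬ Apex (p x)
  p-¬Apex ¬a with ¬Apex⇒rim ¬a
  ... | c , refl = subst (λ y → ¬ Apex y) (sym (⊕-↑ʳ id σ⁻¹ c)) (¬Apex-rim (σ⁻¹ c))

  s^-Apex : ∀ {x} → Apex x → ∀ d → (s ^ d) x ≡ x
  s^-Apex a = ^-fixed s (s-Apex a)

  s^-¬Apex : ∀ d {x} → ¬ Apex x → ¬ Apex ((s ^ d) x)
  s^-¬Apex = ^-preserves s (λ x → ¬ Apex x) s-¬Apex

  s^-self⇔ : ∀ {x a b} → ¬ Apex x → a < N → b < N → ((s ^ a) x ≡ (s ^ b) x) ⇔ (a ≡ b)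
  s^-self⇔ {x} {a} {b} ¬a a<N b<N with ¬Apex⇒rim ¬a
  ... | c , refl = mk⇔ (λ e → orbit-injective c a<N b<N (FP.↑ʳ-injective K _ _
                          (trans (sym (s^-rim a c)) (trans e (s^-rim b c)))))
                       (λ { refl → refl })

  s^-from-Apex⇔ : ∀ {x z a b} → Apex x → ((s ^ a) x ≡ (s ^ b) z) ⇔ (Apex z × x ≡ z)
  s^-from-Apex⇔ {x} {z} {a} {b} ax = mk⇔ to (λ (az , x≡z) → trans (s^-Apex ax a) (trans x≡z (sym (s^-Apex az b))))
    where
    to : (s ^ a) x ≡ (s ^ b) z → Apex z × x ≡ z
    to e with Apex? z
    ... | yes az = az , trans (sym (s^-Apex ax a)) (trans e (s^-Apex az b))
    ... | no ¬az = contradiction (subst Apex (trans (sym (s^-Apex ax a)) e) ax) (s^-¬Apex b ¬az)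

  shift⇔ : ∀ {x z u v} → (s ^ v) x ≡ (s ^ u) z → ∀ a b w →
           ((s ^ a) x ≡ (s ^ b) w) ⇔ ((s ^ (a + u)) z ≡ (s ^ (v + b)) w)
  shift⇔ {x} {z} {u} {v} e a b w =
    mk⇔ (λ e′ → trans lhs (trans (cong (s ^ v) e′) (sym rhs)))
        (λ e′ → ^-injective s s-injective v (trans (sym lhs) (trans e′ rhs)))
    where
    open ≡-Reasoning
    lhs : (s ^ (a + u)) z ≡ (s ^ v) ((s ^ a) x)
    lhs = begin
      (s ^ (a + u)) z       ≡⟨ ^-+ s a u z ⟨
      (s ^ a) ((s ^ u) z)   ≡⟨ cong (s ^ a) e ⟨
      (s ^ a) ((s ^ v) x)   ≡⟨ ^-comm s a v x ⟩
      (s ^ v) ((s ^ a) x)   ∎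
    rhs : (s ^ (v + b)) w ≡ (s ^ v) ((s ^ b) w)
    rhs = sym (^-+ s v b w)

  Near : ℕ → V → V → Set
  Near T x z = ∃ λ u → u < T × ∃ λ v → v < T × (s ^ u) x ≡ (s ^ v) z

  Near? : ∀ T x z → Dec (Near T x z)
  Near? T x z = anyUpTo? (λ u → anyUpTo? (λ v → (s ^ u) x FP.≟ (s ^ v) z) T) T

  not-near-both : ∀ {T z x P Q} → ¬ Apex x → T + T + P ≤ Q → T + T + Q ≤ N →
                          Near T z ((s ^ P) x) → ¬ Near T z ((s ^ Q) x)
  not-near-both {T} {z} {x} {P} {Q} ¬x P≪Q Q≪N (u₁ , u₁<T , v₁ , v₁<T , e₁) (u₂ , u₂<T , v₂ , v₂<T , e₂) =
    <⇒≢ a<b (Equivalence.to (s^-self⇔ ¬x (<-trans a<b b<N) b<N) meet)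
    where
    open ≡-Reasoning
    a = u₂ + (v₁ + P)
    b = u₁ + (v₂ + Q)
    bounded : ∀ {u v R} → u < T → v < T → u + (v + R) < T + T + R
    bounded {u} {v} {R} u<T v<T = subst (_< T + T + R) (+-assoc u v R) (+-monoˡ-< R (+-mono-< u<T v<T))
    a<b : a < b
    a<b = <-≤-trans (bounded u₂<T v₁<T) (≤-trans P≪Q (≤-trans (m≤n+m Q v₂) (m≤n+m (v₂ + Q) u₁)))
    b<N : b < N
    b<N = <-≤-trans (bounded u₁<T v₂<T) Q≪N
    meet : (s ^ a) x ≡ (s ^ b) x
    meet = begin
      (s ^ (u₂ + (v₁ + P))) x          ≡⟨ ^-+ s u₂ (v₁ + P) x ⟨
      (s ^ u₂) ((s ^ (v₁ + P)) x)      ≡⟨ cong (s ^ u₂) (^-+ s v₁ P x) ⟨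
      (s ^ u₂) ((s ^ v₁) ((s ^ P) x))  ≡⟨ cong (s ^ u₂) e₁ ⟨
      (s ^ u₂) ((s ^ u₁) z)            ≡⟨ ^-comm s u₂ u₁ z ⟩
      (s ^ u₁) ((s ^ u₂) z)            ≡⟨ cong (s ^ u₁) e₂ ⟩
      (s ^ u₁) ((s ^ v₂) ((s ^ Q) x))  ≡⟨ cong (s ^ u₁) (^-+ s v₂ Q x) ⟩
      (s ^ u₁) ((s ^ (v₂ + Q)) x)      ≡⟨ ^-+ s u₁ (v₂ + Q) x ⟩
      (s ^ (u₁ + (v₂ + Q))) x          ∎

  module _ (c₀ : Fin L) {m : ℕ} (ρ : Fin m → V) (T : ℕ) where

    candidate : Fin (suc m) → V
    candidate t = (s ^ ((T + T) * toℕ t)) (rim c₀)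

    -- Of the m + 1 candidates, spaced 2T apart along the orbit of c₀, two near the same ρ i
    -- would contradict not-near-both; so by pigeonhole one candidate is far from all of ρ.
    far-vertex : (T + T) * suc m ≤ N → ∃ λ y → ¬ Apex y × (∀ i → ¬ Near T (ρ i) y)
    far-vertex bound with FP.any? (λ t → ¬? (FP.any? (λ i → Near? T (ρ i) (candidate t))))
    ... | yes (t , unblocked) = candidate t , s^-¬Apex ((T + T) * toℕ t) (¬Apex-rim c₀) , λ i near → unblocked (i , near)
    ... | no ¬unblocked = contradiction (FP.pigeonhole (n<1+n m) (proj₁ ∘ blocked)) shared-blocker-impossible
      where
      blocked : ∀ t → ∃ λ i → Near T (ρ i) (candidate t)
      blocked t with FP.any? (λ i → Near? T (ρ i) (candidate t))
      ... | yes b = b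
      ... | no ¬b = contradiction (t , ¬b) ¬unblocked
      spacing : ∀ {a b} → a < b → T + T + (T + T) * a ≤ (T + T) * b
      spacing {a} {b} a<b = subst (_≤ (T + T) * b) (*-suc (T + T) a) (*-monoʳ-≤ (T + T) a<b)
      shared-blocker-impossible : ¬ (∃₂ λ t₁ t₂ → t₁ F.< t₂ × proj₁ (blocked t₁) ≡ proj₁ (blocked t₂))
      shared-blocker-impossible (t₁ , t₂ , t₁<t₂ , same) =
        not-near-both (¬Apex-rim c₀) (spacing t₁<t₂) (≤-trans (spacing (FP.toℕ<n t₂)) bound)
          (subst (λ i → Near T (ρ i) (candidate t₁)) same (proj₂ (blocked t₁))) (proj₂ (blocked t₂))

≡-sym-⇔ : ∀ {A B : Set} {a b : A} {c d : B} → (a ≡ b) ⇔ (c ≡ d) → (b ≡ a) ⇔ (d ≡ c)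
≡-sym-⇔ e = mk⇔ (λ q → sym (Equivalence.to e (sym q))) (λ q → sym (Equivalence.from e (sym q)))

module Similarity (K : ℕ) {L N : ℕ} (C₁ C₂ : LongCycles L N) where
  module G₁ = ConeOf K C₁
  module G₂ = ConeOf K C₂
  open G₁ using (V; Apex)

  -- A position of the back-and-forth game; each round halves the distance threshold T.
  record Similar (T : ℕ) {m} (ρ₁ ρ₂ : Fin m → V) : Set where
    field
      orbits : ∀ i j u v → u < T → v < T →
               ((G₁.s ^ u) (ρ₁ i) ≡ (G₁.s ^ v) (ρ₁ j)) ⇔ ((G₂.s ^ u) (ρ₂ i) ≡ (G₂.s ^ v) (ρ₂ j))
      apex₁  : ∀ i → Apex (ρ₁ i) → ρ₂ i ≡ ρ₁ i
      apex₂  : ∀ i → Apex (ρ₂ i) → ρ₁ i ≡ ρ₂ i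
  open Similar public

  T≤N : ∀ {T m} → (T + T) * suc m ≤ N → T ≤ N
  T≤N {T} {m} bound = ≤-trans (m≤m+n T T) (≤-trans (m≤m*n (T + T) (suc m)) bound)

  module _ {T m : ℕ} {ρ₁ ρ₂ : Fin m → V} (sim : Similar (T + T) ρ₁ ρ₂) where

    Similar-extend : ∀ {x y} →
      (∀ u v → u < T → v < T → ((G₁.s ^ u) x ≡ (G₁.s ^ v) x) ⇔ ((G₂.s ^ u) y ≡ (G₂.s ^ v) y)) →
      (∀ j u v → u < T → v < T → ((G₁.s ^ u) x ≡ (G₁.s ^ v) (ρ₁ j)) ⇔ ((G₂.s ^ u) y ≡ (G₂.s ^ v) (ρ₂ j))) →
      (Apex x → y ≡ x) → (Apex y → x ≡ y) → Similar T (extend x ρ₁) (extend y ρ₂)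
    Similar-extend {x} {y} self cross ax ay = record { orbits = orbits′ ; apex₁ = apex₁′ ; apex₂ = apex₂′ }
      where
      wide : ∀ {u} → u < T → u < T + T
      wide u<T = <-≤-trans u<T (m≤m+n T T)
      orbits′ : ∀ i j u v → u < T → v < T →
                ((G₁.s ^ u) (extend x ρ₁ i) ≡ (G₁.s ^ v) (extend x ρ₁ j)) ⇔
                ((G₂.s ^ u) (extend y ρ₂ i) ≡ (G₂.s ^ v) (extend y ρ₂ j))
      orbits′ F.zero    F.zero    u v u<T v<T = self u v u<T v<T
      orbits′ F.zero    (F.suc j) u v u<T v<T = cross j u v u<T v<T
      orbits′ (F.suc i) F.zero    u v u<T v<T = ≡-sym-⇔ (cross i v u v<T u<T)
      orbits′ (F.suc i) (F.suc j) u v u<T v<T = orbits sim i j u v (wide u<T) (wide v<T)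
      apex₁′ : ∀ i → Apex (extend x ρ₁ i) → extend y ρ₂ i ≡ extend x ρ₁ i
      apex₁′ F.zero    = ax
      apex₁′ (F.suc i) = apex₁ sim i
      apex₂′ : ∀ i → Apex (extend y ρ₂ i) → extend x ρ₁ i ≡ extend y ρ₂ i
      apex₂′ F.zero    = ay
      apex₂′ (F.suc i) = apex₂ sim i

    forth-apex : ∀ {x} → Apex x → Similar T (extend x ρ₁) (extend x ρ₂)
    forth-apex {x} ax = Similar-extend self cross (λ _ → refl) (λ _ → refl)
      where
      self : ∀ u v → u < T → v < T → ((G₁.s ^ u) x ≡ (G₁.s ^ v) x) ⇔ ((G₂.s ^ u) x ≡ (G₂.s ^ v) x)
      self u v _ _ = mk⇔ (λ _ → trans (G₂.s^-Apex ax u) (sym (G₂.s^-Apex ax v)))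
                         (λ _ → trans (G₁.s^-Apex ax u) (sym (G₁.s^-Apex ax v)))
      apexes-agree : ∀ j → (Apex (ρ₁ j) × x ≡ ρ₁ j) ⇔ (Apex (ρ₂ j) × x ≡ ρ₂ j)
      apexes-agree j = mk⇔ (λ (a , e) → let e′ = apex₁ sim j a in subst Apex (sym e′) a , trans e (sym e′))
                           (λ (a , e) → let e′ = apex₂ sim j a in subst Apex (sym e′) a , trans e (sym e′))
      cross : ∀ j u v → u < T → v < T → ((G₁.s ^ u) x ≡ (G₁.s ^ v) (ρ₁ j)) ⇔ ((G₂.s ^ u) x ≡ (G₂.s ^ v) (ρ₂ j))
      cross j u v _ _ = begin
        ((G₁.s ^ u) x ≡ (G₁.s ^ v) (ρ₁ j))  ∼⟨ G₁.s^-from-Apex⇔ {a = u} {b = v} ax ⟩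
        (Apex (ρ₁ j) × x ≡ ρ₁ j)            ∼⟨ apexes-agree j ⟩
        (Apex (ρ₂ j) × x ≡ ρ₂ j)            ∼⟨ ⇔-sym (G₂.s^-from-Apex⇔ {a = u} {b = v} ax) ⟩
        ((G₂.s ^ u) x ≡ (G₂.s ^ v) (ρ₂ j))  ∎
        where open EquationalReasoning

    self-off-apex : ∀ {x y} → T ≤ N → ¬ Apex x → ¬ Apex y →
                    ∀ u v → u < T → v < T → ((G₁.s ^ u) x ≡ (G₁.s ^ v) x) ⇔ ((G₂.s ^ u) y ≡ (G₂.s ^ v) y)
    self-off-apex T≤N ¬ax ¬ay u v u<T v<T = begin
      _        ∼⟨ G₁.s^-self⇔ ¬ax (<-≤-trans u<T T≤N) (<-≤-trans v<T T≤N) ⟩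
      (u ≡ v)  ∼⟨ ⇔-sym (G₂.s^-self⇔ ¬ay (<-≤-trans u<T T≤N) (<-≤-trans v<T T≤N)) ⟩
      _        ∎
      where open EquationalReasoning

    forth-near : ∀ {x} → T ≤ N → ¬ Apex x → ∀ i → G₁.Near T (ρ₁ i) x →
                 ∃ λ y → Similar T (extend x ρ₁) (extend y ρ₂)
    forth-near {x} T≤N ¬ax i (u′ , u′<T , v′ , v′<T , e₁) =
      y , Similar-extend (self-off-apex T≤N ¬ax ¬ay) cross (λ ax → contradiction ax ¬ax) (λ ay → contradiction ay ¬ay)
      where
      -- y sits relative to ρ₂ i exactly as x sits relative to ρ₁ i.
      y = (G₂.p ^ v′) ((G₂.s ^ u′) (ρ₂ i))
      e₂ : (G₂.s ^ v′) y ≡ (G₂.s ^ u′) (ρ₂ i)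
      e₂ = ^-inverse G₂.s∘p v′ _
      ¬aρ₂i : ¬ Apex (ρ₂ i)
      ¬aρ₂i a = G₁.s^-¬Apex v′ ¬ax (subst Apex (trans (sym (G₁.s^-Apex aρ₁i u′)) e₁) aρ₁i)
        where
        aρ₁i : Apex (ρ₁ i)
        aρ₁i = subst Apex (sym (apex₂ sim i a)) a
      ¬ay : ¬ Apex y
      ¬ay = ^-preserves G₂.p (λ z → ¬ Apex z) G₂.p-¬Apex v′ (G₂.s^-¬Apex u′ ¬aρ₂i)
      cross : ∀ j a b → a < T → b < T → ((G₁.s ^ a) x ≡ (G₁.s ^ b) (ρ₁ j)) ⇔ ((G₂.s ^ a) y ≡ (G₂.s ^ b) (ρ₂ j))
      cross j a b a<T b<T = begin
        ((G₁.s ^ a) x ≡ (G₁.s ^ b) (ρ₁ j))                           ∼⟨ G₁.shift⇔ {u = u′} {v = v′} (sym e₁) a b (ρ₁ j) ⟩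
        ((G₁.s ^ (a + u′)) (ρ₁ i) ≡ (G₁.s ^ (v′ + b)) (ρ₁ j))        ∼⟨ orbits sim i j _ _ (+-mono-< a<T u′<T) (+-mono-< v′<T b<T) ⟩
        ((G₂.s ^ (a + u′)) (ρ₂ i) ≡ (G₂.s ^ (v′ + b)) (ρ₂ j))        ∼⟨ ⇔-sym (G₂.shift⇔ {u = u′} {v = v′} e₂ a b (ρ₂ j)) ⟩
        ((G₂.s ^ a) y ≡ (G₂.s ^ b) (ρ₂ j))                           ∎
        where open EquationalReasoning

    forth-far : ∀ (c₀ : Fin L) {x} → (T + T) * suc m ≤ N → ¬ Apex x → (∀ i → ¬ G₁.Near T (ρ₁ i) x) →
                ∃ λ y → Similar T (extend x ρ₁) (extend y ρ₂)
    forth-far c₀ {x} bound ¬ax far₁ with G₂.far-vertex c₀ ρ₂ T bound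
    ... | y , ¬ay , far₂ =
      y , Similar-extend (self-off-apex (T≤N bound) ¬ax ¬ay) cross (λ ax → contradiction ax ¬ax) (λ ay → contradiction ay ¬ay)
      where
      cross : ∀ j a b → a < T → b < T → ((G₁.s ^ a) x ≡ (G₁.s ^ b) (ρ₁ j)) ⇔ ((G₂.s ^ a) y ≡ (G₂.s ^ b) (ρ₂ j))
      cross j a b a<T b<T = mk⇔ (λ e → contradiction (b , b<T , a , a<T , sym e) (far₁ j))
                                (λ e → contradiction (b , b<T , a , a<T , sym e) (far₂ j))

  forth : ∀ (c₀ : Fin L) {T m} (ρ₁ ρ₂ : Fin m → V) → (T + T) * suc m ≤ N → Similar (T + T) ρ₁ ρ₂ →
          ∀ x → ∃ λ y → Similar T (extend x ρ₁) (extend y ρ₂)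
  forth c₀ {T} ρ₁ ρ₂ bound sim x with G₁.Apex? x
  ... | yes ax = x , forth-apex sim ax
  ... | no ¬ax with FP.any? (λ i → G₁.Near? T (ρ₁ i) x)
  ...   | yes (i , near) = forth-near sim (T≤N bound) ¬ax i near
  ...   | no ¬near = forth-far sim c₀ bound ¬ax (λ i near → ¬near (i , near))

qr : ∀ {k m} → Formula k m → ℕ
qr (edge _ _)        = 0
qr (equal _ _)       = 0
qr (conn _ _ _ _ _)  = 0
qr false'            = 0
qr true'             = 0
qr (neg φ)           = qr φ
qr (and φ ψ)         = qr φ ⊔ qr ψ
qr (or φ ψ)          = qr φ ⊔ qr ψ
qr (ex φ)            = suc (qr φ)
qr (all φ)           = suc (qr φ)

threshold : ℕ → ℕ
threshold zero    = 2
threshold (suc r) = threshold r + threshold r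

2≤threshold : ∀ r → 2 ≤ threshold r
2≤threshold zero    = ≤-refl
2≤threshold (suc r) = ≤-trans (2≤threshold r) (m≤m+n _ _)

Similar-sym : ∀ {K L N} {C₁ C₂ : LongCycles L N} {T m} {ρ₁ ρ₂ : Fin m → Fin (K + L)} →
              Similarity.Similar K C₁ C₂ T ρ₁ ρ₂ → Similarity.Similar K C₂ C₁ T ρ₂ ρ₁
Similar-sym sim = record
  { orbits = λ i j u v u<T v<T → ⇔-sym (orbits sim i j u v u<T v<T)
  ; apex₁  = apex₂ sim
  ; apex₂  = apex₁ sim
  }
  where open Similarity.Similar

∈-map-⇔ : ∀ {A B : Set} {m ℓ} (ρ₁ : Fin m → A) (ρ₂ : Fin m → B) →
          (∀ x y → (ρ₁ x ≡ ρ₁ y) ⇔ (ρ₂ x ≡ ρ₂ y)) →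
          ∀ a (cs : Vec (Fin m) ℓ) → (ρ₁ a ∈ mapVec ρ₁ cs) ⇔ (ρ₂ a ∈ mapVec ρ₂ cs)
∈-map-⇔ ρ₁ ρ₂ eq a []       = mk⇔ (λ ()) (λ ())
∈-map-⇔ ρ₁ ρ₂ eq a (c ∷ cs) = mk⇔ to from
  where
  rest = ∈-map-⇔ ρ₁ ρ₂ eq a cs
  to : ρ₁ a ∈ mapVec ρ₁ (c ∷ cs) → ρ₂ a ∈ mapVec ρ₂ (c ∷ cs)
  to (here e)  = here (Equivalence.to (eq a c) e)
  to (there p) = there (Equivalence.to rest p)
  from : ρ₂ a ∈ mapVec ρ₂ (c ∷ cs) → ρ₁ a ∈ mapVec ρ₁ (c ∷ cs)
  from (here e)  = here (Equivalence.from (eq a c) e)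
  from (there p) = there (Equivalence.from rest p)

module Indistinguishable (k : ℕ) {L N : ℕ} (C₁ C₂ : LongCycles L N) (c₀ : Fin L) where
  open Similarity (suc k) C₁ C₂
  module Back = Similarity (suc k) C₂ C₁
  open G₁ using (Apex)

  module _ {T m} {ρ₁ ρ₂ : Fin m → G₁.V} (2≤T : 2 ≤ T) (sim : Similar T ρ₁ ρ₂) where

    equal⇔ : ∀ x y → (ρ₁ x ≡ ρ₁ y) ⇔ (ρ₂ x ≡ ρ₂ y)
    equal⇔ x y = orbits sim x y 0 0 (<-≤-trans (s≤s z≤n) 2≤T) (<-≤-trans (s≤s z≤n) 2≤T)

    Apex⇔ : ∀ x → Apex (ρ₁ x) ⇔ Apex (ρ₂ x)
    Apex⇔ x = mk⇔ (λ a → subst Apex (sym (apex₁ sim x a)) a) (λ a → subst Apex (sym (apex₂ sim x a)) a)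

    Adj⇔ : ∀ x y → Adj G₁.graph (ρ₁ x) (ρ₁ y) ⇔ Adj G₂.graph (ρ₂ x) (ρ₂ y)
    Adj⇔ x y = begin
      Adj G₁.graph (ρ₁ x) (ρ₁ y)  ∼⟨ G₁.Adj⇔Edge ⟩
      G₁.Edge (ρ₁ x) (ρ₁ y)       ∼⟨ ¬-cong-⇔ (equal⇔ x y) ×-⇔ (Apex⇔ x ⊎-⇔ Apex⇔ y ⊎-⇔ successor⇔ x y ⊎-⇔ successor⇔ y x) ⟩
      G₂.Edge (ρ₂ x) (ρ₂ y)       ∼⟨ ⇔-sym G₂.Adj⇔Edge ⟩
      Adj G₂.graph (ρ₂ x) (ρ₂ y)  ∎
      where
      open EquationalReasoning
      successor⇔ : ∀ x y → (G₁.s (ρ₁ x) ≡ ρ₁ y) ⇔ (G₂.s (ρ₂ x) ≡ ρ₂ y)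
      successor⇔ x y = orbits sim x y 1 0 2≤T (<-≤-trans (s≤s z≤n) 2≤T)

    Reach⇔ : ∀ {ℓ} → ℓ ≤ k → ∀ a b (cs : Vec (Fin m) ℓ) →
             Reach G₁.graph (_∈ mapVec ρ₁ cs) (ρ₁ a) (ρ₁ b) ⇔ Reach G₂.graph (_∈ mapVec ρ₂ cs) (ρ₂ a) (ρ₂ b)
    Reach⇔ ℓ≤k a b cs = begin
      Reach G₁.graph (_∈ mapVec ρ₁ cs) (ρ₁ a) (ρ₁ b)  ∼⟨ G₁.Reach-avoiding-few⇔ (mapVec ρ₁ cs) (s≤s ℓ≤k) ⟩
      _                                                ∼⟨ ¬-cong-⇔ (∈-map-⇔ ρ₁ ρ₂ equal⇔ a cs) ×-⇔ ¬-cong-⇔ (∈-map-⇔ ρ₁ ρ₂ equal⇔ b cs) ⟩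
      _                                                ∼⟨ ⇔-sym (G₂.Reach-avoiding-few⇔ (mapVec ρ₂ cs) (s≤s ℓ≤k)) ⟩
      Reach G₂.graph (_∈ mapVec ρ₂ cs) (ρ₂ a) (ρ₂ b)  ∎
      where open EquationalReasoning

  forth-bound : ∀ m r → threshold (suc r) * (m + suc r) ≤ N → (threshold r + threshold r) * suc m ≤ N
  forth-bound m r bound = ≤-trans (*-monoʳ-≤ (threshold (suc r)) (subst (suc m ≤_) (sym (+-suc m r)) (s≤s (m≤m+n m r)))) bound

  inner-bound : ∀ m r → threshold (suc r) * (m + suc r) ≤ N → threshold r * (suc m + r) ≤ N
  inner-bound m r bound = ≤-trans (*-mono-≤ (m≤m+n (threshold r) (threshold r)) (≤-reflexive (sym (+-suc m r)))) bound

  -- The bound leaves room for far-vertex in every remaining round.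
  Sat⇔ : ∀ {m} (φ : Formula k m) r {ρ₁ ρ₂ : Fin m → G₁.V} → qr φ ≤ r → threshold r * (m + r) ≤ N →
         Similar (threshold r) ρ₁ ρ₂ → Sat G₁.graph ρ₁ φ ⇔ Sat G₂.graph ρ₂ φ
  Sat⇔ (edge x y)          r _ _ sim = Adj⇔ (2≤threshold r) sim x y
  Sat⇔ (equal x y)         r _ _ sim = equal⇔ (2≤threshold r) sim x y
  Sat⇔ (conn ℓ ℓ≤k a b cs) r _ _ sim = Reach⇔ (2≤threshold r) sim ℓ≤k a b cs
  Sat⇔ false'              r _ _ _   = mk⇔ (λ ()) (λ ())
  Sat⇔ true'               r _ _ _   = mk⇔ (λ _ → tt) (λ _ → tt)
  Sat⇔ (neg φ)             r q b sim = ¬-cong-⇔ (Sat⇔ φ r q b sim)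
  Sat⇔ (and φ ψ)           r q b sim = Sat⇔ φ r (m⊔n≤o⇒m≤o _ _ q) b sim ×-⇔ Sat⇔ ψ r (m⊔n≤o⇒n≤o _ _ q) b sim
  Sat⇔ (or φ ψ)            r q b sim = Sat⇔ φ r (m⊔n≤o⇒m≤o _ _ q) b sim ⊎-⇔ Sat⇔ ψ r (m⊔n≤o⇒n≤o _ _ q) b sim
  Sat⇔ {m} (ex φ) (suc r) {ρ₁} {ρ₂} (s≤s q) bound sim = mk⇔
    (λ (x , sat) → let (y , sim′) = forth c₀ ρ₁ ρ₂ (forth-bound m r bound) sim x
                   in y , Equivalence.to (Sat⇔ φ r q (inner-bound m r bound) sim′) sat)
    (λ (y , sat) → let (x , sim′) = Back.forth c₀ ρ₂ ρ₁ (forth-bound m r bound) (Similar-sym sim) y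
                   in x , Equivalence.from (Sat⇔ φ r q (inner-bound m r bound) (Similar-sym sim′)) sat)
  Sat⇔ {m} (all φ) (suc r) {ρ₁} {ρ₂} (s≤s q) bound sim = mk⇔
    (λ sat y → let (x , sim′) = Back.forth c₀ ρ₂ ρ₁ (forth-bound m r bound) (Similar-sym sim) y
               in Equivalence.to (Sat⇔ φ r q (inner-bound m r bound) (Similar-sym sim′)) (sat x))
    (λ sat x → let (y , sim′) = forth c₀ ρ₁ ρ₂ (forth-bound m r bound) sim x
               in Equivalence.from (Sat⇔ φ r q (inner-bound m r bound) sim′) (sat y))

  cones-agree : (φ : Sentence k) → threshold (qr φ) * qr φ ≤ N → G₁.graph ⊨ φ ⇔ G₂.graph ⊨ φ
  cones-agree φ bound = Sat⇔ φ (qr φ) ≤-refl bound (record { orbits = λ () ; apex₁ = λ () ; apex₂ = λ () })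

apexSet : ∀ K L → Subset (K + L)
apexSet K L = replicate K inside ++ replicate L outside

apex∈apexSet : ∀ {K} L (i : Fin K) → i ↑ˡ L ∈ₛ apexSet K L
apex∈apexSet L F.zero    = Vec.here
apex∈apexSet L (F.suc i) = Vec.there (apex∈apexSet L i)

rim∉apexSet : ∀ K {L} (c : Fin L) → K ↑ʳ c ∉ₛ apexSet K L
rim∉apexSet zero    c c∈           = SP.∉⊥ c∈
rim∉apexSet (suc K) c (Vec.there c∈) = rim∉apexSet K c c∈

∣apexSet∣≡K : ∀ K L → ∣ apexSet K L ∣ ≡ K
∣apexSet∣≡K zero    L = SP.∣⊥∣≡0 L
∣apexSet∣≡K (suc K) L = cong suc (∣apexSet∣≡K K L)

isOneOf : ∀ {k m ℓ} → Fin m → Vec (Fin m) ℓ → Formula k m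
isOneOf a []       = false'
isOneOf a (c ∷ cs) = or (equal a c) (isOneOf a cs)

Sat-isOneOf⇔ : ∀ {k m ℓ} (G : Graph) (ρ : Fin m → Fin (Graph.n G)) a (cs : Vec (Fin m) ℓ) →
               Sat {k} G ρ (isOneOf a cs) ⇔ ρ a ∈ mapVec ρ cs
Sat-isOneOf⇔ G ρ a cs = mk⇔ (to cs) (from cs)
  where
  to : ∀ {ℓ} (cs : Vec _ ℓ) → Sat G ρ (isOneOf a cs) → ρ a ∈ mapVec ρ cs
  to (c ∷ cs) (inj₁ e) = here e
  to (c ∷ cs) (inj₂ p) = there (to cs p)
  from : ∀ {ℓ} (cs : Vec _ ℓ) → ρ a ∈ mapVec ρ cs → Sat G ρ (isOneOf a cs)
  from (c ∷ cs) (here e)  = inj₁ e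
  from (c ∷ cs) (there p) = inj₂ (from cs p)

-- ∀ z₁ … z_r. conn_{k+1}(a, b, cs z) ∨ a ∈ cs z ∨ b ∈ cs z, the z's being added to the list cs.
stillJoined : ∀ k r {m ℓ} → r + ℓ ≡ suc k → Fin m → Fin m → Vec (Fin m) ℓ → Formula (suc k) m
stillJoined k zero    {ℓ = ℓ} e a b cs = or (conn ℓ (≤-reflexive e) a b cs) (or (isOneOf a cs) (isOneOf b cs))
stillJoined k (suc r) {ℓ = ℓ} e a b cs =
  all (stillJoined k r (trans (+-suc r ℓ) e) (F.suc a) (F.suc b) (F.zero ∷ Vec.map F.suc cs))

noSeparator : ∀ k → Sentence (suc k)
noSeparator k = all (all (stillJoined k (suc k) (+-identityʳ (suc k)) (F.suc F.zero) F.zero []))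

map-extend-suc : ∀ {A : Set} {m ℓ} (w : A) (ρ : Fin m → A) (cs : Vec (Fin m) ℓ) →
                 mapVec (extend w ρ) (Vec.map F.suc cs) ≡ mapVec ρ cs
map-extend-suc w ρ cs = sym (map-∘ (extend w ρ) F.suc cs)

module ConeConnectivity (k L : ℕ) (σ : Fin L → Fin L) where
  open Cone (suc k) L σ public

  K<k+2 : suc k < k + 2
  K<k+2 = subst (suc (suc k) ≤_) (+-comm 2 k) ≤-refl

  open DecMembership (FP._≟_ {suc k + L}) using (_∈?_)

  listed-apexes-fill : ∀ {ℓ} (xs : Vec V ℓ) → ℓ ≤ suc k → (∀ i → apex i ∈ xs) → ∀ {x} → ¬ Apex x → x ∉ xs
  listed-apexes-fill xs ℓ≤K apexes∈ {x} ¬ax x∈ = injective-image-⊈ f f-injective (s≤s ℓ≤K) xs f⊆xs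
    where
    f : Fin (suc (suc k)) → V
    f F.zero    = x
    f (F.suc i) = apex i
    f-injective : ∀ {i j} → f i ≡ f j → i ≡ j
    f-injective {F.zero}  {F.zero}  _ = refl
    f-injective {F.zero}  {F.suc j} e = contradiction (subst Apex (sym e) (Apex-apex j)) ¬ax
    f-injective {F.suc i} {F.zero}  e = contradiction (subst Apex e (Apex-apex i)) ¬ax
    f-injective {F.suc i} {F.suc j} e = cong F.suc (apex-injective e)
    f⊆xs : ∀ i → f i ∈ xs
    f⊆xs F.zero    = x∈
    f⊆xs (F.suc i) = apexes∈ i

  apexes⊂ : ∀ (X : Subset (suc k + L)) → (∀ i → apex i ∈ₛ X) → ∀ {c} → rim c ∈ₛ X → suc k < ∣ X ∣
  apexes⊂ X apexes∈ {c} c∈ = subst (_< ∣ X ∣) (∣apexSet∣≡K (suc k) L) (SP.p⊂q⇒∣p∣<∣q∣ (⊆X , rim c , c∈ , rim∉apexSet (suc k) c))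
    where
    ⊆X : ∀ {x} → x ∈ₛ apexSet (suc k) L → x ∈ₛ X
    ⊆X {x} x∈ with sumView (suc k) L x
    ... | inl i = apexes∈ i
    ... | inr c = contradiction x∈ (rim∉apexSet (suc k) c)

  module _ (transitive : ∀ c c′ → ∃ λ d → (σ ^ d) c ≡ c′) where

    cone-connected : 2 ≤ L → IsConnectedₘ (k + 2) graph
    cone-connected 2≤L = +-monoʳ-≤ (suc k) 2≤L , λ X ∣X∣<k+2 a b a∉ b∉ →
      reach-in-cone transitive (SP._∈? X) (only-apexes X ∣X∣<k+2) a∉ b∉
      where
      only-apexes : ∀ X → ∣ X ∣ < k + 2 → (∀ i → apex i ∈ₛ X) → ∀ {x} → ¬ Apex x → x ∉ₛ X
      only-apexes X ∣X∣<k+2 apexes∈ ¬ax x∈ with ¬Apex⇒rim ¬ax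
      ... | c , refl = <⇒≱ ∣X∣<k+2 (subst (_≤ ∣ X ∣) (+-comm 2 k) (apexes⊂ X apexes∈ x∈))

    stillJoined-holds : ∀ r {m ℓ} (e : r + ℓ ≡ suc k) (ρ : Fin m → V) a b (cs : Vec (Fin m) ℓ) →
                        Sat graph ρ (stillJoined k r e a b cs)
    stillJoined-holds zero e ρ a b cs with ρ a ∈? mapVec ρ cs | ρ b ∈? mapVec ρ cs
    ... | yes a∈ | _      = inj₂ (inj₁ (Equivalence.from (Sat-isOneOf⇔ graph ρ a cs) a∈))
    ... | no _   | yes b∈ = inj₂ (inj₂ (Equivalence.from (Sat-isOneOf⇔ graph ρ b cs) b∈))
    ... | no a∉  | no b∉  = inj₁ (reach-in-cone transitive (_∈? mapVec ρ cs)
                                    (listed-apexes-fill (mapVec ρ cs) (≤-reflexive e)) a∉ b∉)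
    stillJoined-holds (suc r) e ρ a b cs v =
      stillJoined-holds r _ (extend v ρ) (F.suc a) (F.suc b) (F.zero ∷ Vec.map F.suc cs)

    noSeparator-holds : graph ⊨ noSeparator k
    noSeparator-holds v w = stillJoined-holds (suc k) _ (extend w (extend v noVars)) (F.suc F.zero) F.zero []

  module _ {c c′ : Fin L} (separated : ∀ {A : V → Set} → (∀ i → A (apex i)) → ¬ Reach graph A (rim c) (rim c′)) where

    cone-disconnected : ¬ IsConnectedₘ (k + 2) graph
    cone-disconnected (_ , connected) = separated (apex∈apexSet L)
      (connected (apexSet (suc k) L) (subst (_< k + 2) (sym (∣apexSet∣≡K (suc k) L)) K<k+2)
                 (rim c) (rim c′) (rim∉apexSet (suc k) c) (rim∉apexSet (suc k) c′))

    stillJoined-fails : ∀ r {m ℓ} (e : r + ℓ ≡ suc k) (ρ : Fin m → V) a b (cs : Vec (Fin m) ℓ) →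
                        ρ a ≡ rim c → ρ b ≡ rim c′ → (∀ {x} → x ∈ mapVec ρ cs → Apex x) →
                        (∀ i → toℕ i < ℓ → apex i ∈ mapVec ρ cs) → ¬ Sat graph ρ (stillJoined k r e a b cs)
    stillJoined-fails zero refl ρ a b cs ρa ρb listed-apex apexes-listed (inj₁ joined) =
      separated (λ i → apexes-listed i (FP.toℕ<n i)) (subst₂ (Reach graph _) ρa ρb joined)
    stillJoined-fails zero _ ρ a b cs ρa ρb listed-apex apexes-listed (inj₂ (inj₁ a∈)) =
      ¬Apex-rim c (subst Apex ρa (listed-apex (Equivalence.to (Sat-isOneOf⇔ graph ρ a cs) a∈)))
    stillJoined-fails zero _ ρ a b cs ρa ρb listed-apex apexes-listed (inj₂ (inj₂ b∈)) =
      ¬Apex-rim c′ (subst Apex ρb (listed-apex (Equivalence.to (Sat-isOneOf⇔ graph ρ b cs) b∈)))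
    stillJoined-fails (suc r) {ℓ = ℓ} e ρ a b cs ρa ρb listed-apex apexes-listed sat =
      stillJoined-fails r _ (extend v ρ) (F.suc a) (F.suc b) (F.zero ∷ Vec.map F.suc cs) ρa ρb
        listed-apex′ apexes-listed′ (sat v)
      where
      ℓ<K : ℓ < suc k
      ℓ<K = subst (suc ℓ ≤_) e (s≤s (m≤n+m ℓ r))
      v = apex (fromℕ< ℓ<K)
      listed-apex′ : ∀ {x} → x ∈ mapVec (extend v ρ) (F.zero ∷ Vec.map F.suc cs) → Apex x
      listed-apex′ (here refl) = Apex-apex (fromℕ< ℓ<K)
      listed-apex′ (there x∈)  = listed-apex (subst (_ ∈_) (map-extend-suc v ρ cs) x∈)
      apexes-listed′ : ∀ i → toℕ i < suc ℓ → apex i ∈ mapVec (extend v ρ) (F.zero ∷ Vec.map F.suc cs)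
      apexes-listed′ i i<1+ℓ with m≤n⇒m<n∨m≡n (≤-pred i<1+ℓ)
      ... | inj₁ i<ℓ = there (subst (_ ∈_) (sym (map-extend-suc v ρ cs)) (apexes-listed i i<ℓ))
      ... | inj₂ i≡ℓ = here (cong apex (FP.toℕ-injective (trans i≡ℓ (sym (FP.toℕ-fromℕ< ℓ<K)))))

    noSeparator-fails : ¬ graph ⊨ noSeparator k
    noSeparator-fails holds = stillJoined-fails (suc k) _ (extend (rim c′) (extend (rim c) noVars)) (F.suc F.zero) F.zero []
                                refl refl (λ ()) (λ i ()) (holds (rim c) (rim c′))

module Witnesses (k Q : ℕ) where

  N : ℕ
  N = suc (threshold Q * Q)

  ring : LongCycles (N + N) N
  ring = rotation (m≤n+m N N)

  twoRings : LongCycles (N + N) N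
  twoRings = rotation ≤-refl ⊕ᶜ rotation ≤-refl

  module One = ConeConnectivity k (N + N) (LongCycles.σ ring)
  module Two = ConeConnectivity k (N + N) (LongCycles.σ twoRings)

  ringCone twoRingsCone : Graph
  ringCone     = One.graph
  twoRingsCone = Two.graph

  cones-agree : (φ : Sentence k) → qr φ ≡ Q → ringCone ⊨ φ ⇔ twoRingsCone ⊨ φ
  cones-agree φ refl = Indistinguishable.cones-agree k ring twoRings F.zero φ (n≤1+n _)

  halves-separated : ∀ {A} → (∀ i → A (Two.apex i)) → ¬ Reach twoRingsCone A (Two.rim (F.zero ↑ˡ N)) (Two.rim (N ↑ʳ F.zero))
  halves-separated apexes∈ joined = contradiction (begin
    true                                     ≡⟨ inLeft-↑ˡ N (F.zero {threshold Q * Q}) ⟨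
    inLeft N (F.zero ↑ˡ N)                   ≡⟨ Two.rim-sides-separated (inLeft N) (inLeft-⊕ rotate rotate) apexes∈ joined ⟩
    inLeft N (N ↑ʳ F.zero {threshold Q * Q}) ≡⟨ inLeft-↑ʳ N F.zero ⟩
    false                                    ∎) (λ ())
    where open ≡-Reasoning

  ringCone-connected : IsConnectedₘ (k + 2) ringCone
  ringCone-connected = One.cone-connected rotate-transitive (+-mono-≤ (s≤s z≤n) (s≤s z≤n))

  twoRingsCone-disconnected : ¬ IsConnectedₘ (k + 2) twoRingsCone
  twoRingsCone-disconnected = Two.cone-disconnected halves-separated

  ringCone-noSeparator : ringCone ⊨ noSeparator k
  ringCone-noSeparator = One.noSeparator-holds rotate-transitive

  twoRingsCone-separator : ¬ twoRingsCone ⊨ noSeparator k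
  twoRingsCone-separator = Two.noSeparator-fails halves-separated

not-expressible : ∀ k (P : GraphProperty) → (∀ Q → P (Witnesses.ringCone k Q)) →
                  (∀ Q → ¬ P (Witnesses.twoRingsCone k Q)) → ¬ Expressible k P
not-expressible k P ring-P twoRings-¬P (φ , defines) =
  twoRings-¬P (qr φ) (proj₁ (defines _) (Equivalence.to (cones-agree φ refl) (proj₂ (defines _) (ring-P (qr φ)))))
  where open Witnesses k (qr φ)

weaken : ∀ {k m} → Formula k m → Formula (suc k) m
weaken (edge x y)          = edge x y
weaken (equal x y)         = equal x y
weaken (conn ℓ ℓ≤k a b cs) = conn ℓ (m≤n⇒m≤1+n ℓ≤k) a b cs
weaken false'              = false'
weaken true'               = true'
weaken (neg φ)             = neg (weaken φ)
weaken (and φ ψ)           = and (weaken φ) (weaken ψ)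
weaken (or φ ψ)            = or (weaken φ) (weaken ψ)
weaken (ex φ)              = ex (weaken φ)
weaken (all φ)             = all (weaken φ)

Sat-weaken⇔ : ∀ {k m} (G : Graph) (ρ : Fin m → Fin (Graph.n G)) (φ : Formula k m) → Sat G ρ (weaken φ) ⇔ Sat G ρ φ
Sat-weaken⇔ G ρ (edge x y)        = mk⇔ id id
Sat-weaken⇔ G ρ (equal x y)       = mk⇔ id id
Sat-weaken⇔ G ρ (conn _ _ _ _ _)  = mk⇔ id id
Sat-weaken⇔ G ρ false'            = mk⇔ id id
Sat-weaken⇔ G ρ true'             = mk⇔ id id
Sat-weaken⇔ G ρ (neg φ)           = ¬-cong-⇔ (Sat-weaken⇔ G ρ φ)
Sat-weaken⇔ G ρ (and φ ψ)         = Sat-weaken⇔ G ρ φ ×-⇔ Sat-weaken⇔ G ρ ψ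
Sat-weaken⇔ G ρ (or φ ψ)          = Sat-weaken⇔ G ρ φ ⊎-⇔ Sat-weaken⇔ G ρ ψ
Sat-weaken⇔ G ρ (ex φ)            = mk⇔ (λ (v , sat) → v , Equivalence.to (Sat-weaken⇔ G (extend v ρ) φ) sat)
                                         (λ (v , sat) → v , Equivalence.from (Sat-weaken⇔ G (extend v ρ) φ) sat)
Sat-weaken⇔ G ρ (all φ)           = mk⇔ (λ sat v → Equivalence.to (Sat-weaken⇔ G (extend v ρ) φ) (sat v))
                                         (λ sat v → Equivalence.from (Sat-weaken⇔ G (extend v ρ) φ) (sat v))

Expressible-weaken : ∀ k (P : GraphProperty) → Expressible k P → Expressible (suc k) P
Expressible-weaken k P (φ , defines) = weaken φ , λ G →
  proj₁ (defines G) ∘ Equivalence.to (Sat-weaken⇔ G noVars φ) , Equivalence.from (Sat-weaken⇔ G noVars φ) ∘ proj₂ (defines G)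

mainTheorem4 : (∀ (k : ℕ) → ¬ Expressible k (IsConnectedₘ (k + 2)))
    × (∀ (k : ℕ) → (∀ (P : GraphProperty) → Expressible k P → Expressible (suc k) P)
         × Σ GraphProperty (λ P → Expressible (suc k) P × ¬ Expressible k P))
mainTheorem4 = connectivity-inexpressible , λ k → Expressible-weaken k , strictly-stronger k
  where
  connectivity-inexpressible : ∀ k → ¬ Expressible k (IsConnectedₘ (k + 2))
  connectivity-inexpressible k =
    not-expressible k _ (Witnesses.ringCone-connected k) (Witnesses.twoRingsCone-disconnected k)
  strictly-stronger : ∀ k → Σ GraphProperty (λ P → Expressible (suc k) P × ¬ Expressible k P)
  strictly-stronger k = (_⊨ noSeparator k) , (noSeparator k , λ G → id , id) ,
    not-expressible k _ (Witnesses.ringCone-noSeparator k) (Witnesses.twoRingsCone-separator k)
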